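{- Consider a zero-one knapsack instance with $n$ items, positive integer weights $w_i$, integer profits $v_i$, and positive integer capacity $W$, and let $\mathcal{S}^*$ be its set of optimal solutions. Let $V(i,w)$ and $C(i,w)$ ($0\le i\le n$, $w\le W$) be the tables defined by: $V(0,w)=0$, $C(0,w)=1$ for $0\le w\le W$; $V(i,w)=-\infty$, $C(i,w)=0$ for $w<0$; and for $1\le i\le n$, $0\le w\le W$: $V(i,w)=\max\{V(i-1,w),V(i-1,w-w_i)+v_i\}$, and $C(i,w)=C(i-1,w)+C(i-1,w-w_i)$ if $V(i-1,w)=V(i-1,w-w_i)+v_i$, $C(i,w)=C(i-1,w)$ if $V(i-1,w)>V(i-1,w-w_i)+v_i$, and $C(i,w)=C(i-1,w-w_i)$ otherwise. Consider the following randomized procedure: set $L=\emptyset$, $i=n$, $w=W$; while $i>0$ and $w>0$: if $w_i\le w$, $V(i,w)=V(i-1,w)$ and $V(i,w)=V(i-1,w-w_i)+v_i$, then with probability $q=C(i-1,w-w_i)/C(i,w)$ (using a fresh uniform random number $r\in[0,1]$ and testing $r<q$) add $i$ to $L$ and set $w\leftarrow w-w_i$; else if $V(i,w)>V(i-1,w)$, add $i$ to $L$ and set $w\leftarrow w-w_i$; then set $i\leftarrow i-1$. Output $L$. Then for every $s\in\mathcal{S}^*$, the probability that the procedure outputs $s$ is $1/|\mathcal{S}^*|$.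
   Context: Zero-one knapsack problem: a solution is a subset $s\subseteq[n]$ with total weight $w(s)=\sum_{i\in s}w_i$ and total value $v(s)=\sum_{i\in s}v_i$. The set of feasible solutions is $\mathcal{S}=\{s\subseteq[n]: w(s)\le W\}$, $v_{\max}=\max_{s\in\mathcal{S}}v(s)$, and $\mathcal{S}^*=\{s\in\mathcal{S}: v(s)=v_{\max}\}$. -}

module Defs where

open import Data.Nat as ℕ using (ℕ; zero; suc; _≤?_; _∸_)
open import Data.Integer as ℤ using (ℤ; +_)
import Data.Integer.Properties as ℤP
open import Data.Rational as ℚ using (ℚ; 0ℚ; 1ℚ)
open import Data.Bool using (Bool; true; false; if_then_else_; _∧_)
open import Data.Fin using (Fin)
open import Data.Fin.Subset using (Subset; inside; ⁅_⁆; _∪_)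
import Data.Fin.Subset
open import Data.Vec using (lookup)
import Data.Vec.Properties as VecP
import Data.Bool.Properties as BoolP
open import Data.List using (List; []; _∷_; reverse; allFin; foldr; map; concatMap)
open import Data.Product using (_×_; _,_; proj₁; proj₂)
open import Relation.Nullary using (yes; no; does)
open import Relation.Binary.PropositionalEquality using (_≡_; refl; cong)

-- Integers extended with -∞ (the value of V(i,w) for w < 0)

data ℤ⊥ : Set where
  -∞  : ℤ⊥
  fin : ℤ → ℤ⊥

_+⊥_ : ℤ⊥ → ℤ → ℤ⊥
-∞    +⊥ v = -∞
fin a +⊥ v = fin (a ℤ.+ v)

_<⊥ᵇ_ : ℤ⊥ → ℤ⊥ → Bool
-∞    <⊥ᵇ -∞    = false
-∞    <⊥ᵇ fin _ = true
fin _ <⊥ᵇ -∞    = false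
fin a <⊥ᵇ fin b with a ℤP.<? b
... | yes _ = true
... | no  _ = false

_==⊥_ : ℤ⊥ → ℤ⊥ → Bool
-∞    ==⊥ -∞    = true
-∞    ==⊥ fin _ = false
fin _ ==⊥ -∞    = false
fin a ==⊥ fin b with a ℤP.≟ b
... | yes _ = true
... | no  _ = false

max⊥ : ℤ⊥ → ℤ⊥ → ℤ⊥
max⊥ a b = if a <⊥ᵇ b then b else a

Dist : Set → Set
Dist A = List (A × ℚ)

return : ∀ {A} → A → Dist A
return a = (a , 1ℚ) ∷ []

_>>=_ : ∀ {A B} → Dist A → (A → Dist B) → Dist B
d >>= f = concatMap (λ p → map (λ q → proj₁ q , proj₂ p ℚ.* proj₂ q) (f (proj₁ p))) d

-- a biased coin: true with probability q (r < q for uniform r ∈ [0,1])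
bernoulli : ℚ → Dist Bool
bernoulli q = (true , q) ∷ (false , 1ℚ ℚ.- q) ∷ []

ratio : ℕ → ℕ → ℚ
ratio a zero    = 0ℚ
ratio a (suc b) = (+ a) ℚ./ suc b

inv : ℕ → ℚ
inv k = ratio 1 k

-- Items are indexed by Fin n; item i (1-based in the paper) is the Fin
-- with toℕ = i - 1.  The "first i items" are represented by the list of
-- their indices in DESCENDING order, so that  x ∷ xs  stands for items
-- 1..i with x = item i and xs = items 1..i-1.

module Knapsack {n : ℕ} (wt : Fin n → ℕ) (val : Fin n → ℤ) (W : ℕ) where

  weight : Subset n → ℕ
  weight s = foldr (λ i acc → (if lookup s i then wt i else 0) ℕ.+ acc) 0 (allFin n)

  value : Subset n → ℤ
  value s = foldr (λ i acc → (if lookup s i then val i else + 0) ℤ.+ acc) (+ 0) (allFin n)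

  Feasible : Subset n → Set
  Feasible s = weight s ℕ.≤ W

  Optimal : Subset n → Set
  Optimal s = Feasible s × (∀ t → Feasible t → value t ℤ.≤ value s)

  V : List (Fin n) → ℕ → ℤ⊥
  Vsub : List (Fin n) → Fin n → ℕ → ℤ⊥

  V []       w = fin (+ 0)
  V (x ∷ xs) w = max⊥ (V xs w) (Vsub xs x w +⊥ val x)

  Vsub xs x w with wt x ≤? w
  ... | yes _ = V xs (w ∸ wt x)
  ... | no  _ = -∞

  C : List (Fin n) → ℕ → ℕ
  Csub : List (Fin n) → Fin n → ℕ → ℕ

  C []       w = 1
  C (x ∷ xs) w =
    if V xs w ==⊥ (Vsub xs x w +⊥ val x) then C xs w ℕ.+ Csub xs x w
    else if (Vsub xs x w +⊥ val x) <⊥ᵇ V xs w then C xs w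
    else Csub xs x w

  Csub xs x w with wt x ≤? w
  ... | yes _ = C xs (w ∸ wt x)
  ... | no  _ = 0

  loop : List (Fin n) → ℕ → Subset n → Dist (Subset n)
  loop []       w       L = return L
  loop (x ∷ xs) zero    L = return L
  loop (x ∷ xs) w@(suc _) L =
    if does (wt x ≤? w) ∧ (V (x ∷ xs) w ==⊥ V xs w)
                        ∧ (V (x ∷ xs) w ==⊥ (V xs (w ∸ wt x) +⊥ val x))
    then (bernoulli (ratio (C xs (w ∸ wt x)) (C (x ∷ xs) w)) >>= λ r<q →
          if r<q then take else skip)
    else if V xs w <⊥ᵇ V (x ∷ xs) w then take
    else skip
    where
      take skip : Dist (Subset n)
      take = loop xs (w ∸ wt x) (L ∪ ⁅ x ⁆)
      skip = loop xs w L

  procedure : Dist (Subset n)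
  procedure = loop (reverse (allFin n)) W Data.Fin.Subset.⊥

  Pr : Subset n → ℚ
  Pr s = foldr (λ p acc → (if does (VecP.≡-dec BoolP._≟_ (proj₁ p) s) then proj₂ p else 0ℚ) ℚ.+ acc)
               0ℚ procedure

{-# OPTIONS --safe #-}
module Submission where

-- V(i,w) is the largest value of a solution using only items 1..i and capacity w.  An optimal
-- solution of (i,w) either omits item i, and is then optimal for (i-1,w), or contains it, and
-- removing it leaves an optimal solution of (i-1,w-w_i); which kinds exist is decided by comparing
-- V(i-1,w) with V(i-1,w-w_i) + v_i, exactly as in the definition of C.  Enumerating the optimal
-- solutions along this recurrence shows that (i,w) has exactly C(i,w) of them, so |S*| = C(n,W).
-- Conversely, at a tie the procedure takes item i with probability C(i-1,w-w_i)/C(i,w), so it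
-- agrees with a fixed optimal s on item i with probability C(i-1,w')/C(i,w), where w' is the
-- capacity s leaves for items 1..i-1; elsewhere it agrees with s with certainty.  By induction it
-- outputs s with probability 1/C(i,w).  Positive weights make C(i,0) = 1, which
-- accounts for the early exit at w = 0.


open import Defs
open import Data.Nat using (ℕ; _<_)
open import Data.Integer using (ℤ)
open import Data.Fin using (Fin)
open import Data.Fin.Subset using (Subset)
open import Data.List using (List; length)
open import Data.List.Membership.Propositional using (_∈_)
open import Data.List.Relation.Unary.Unique.Propositional using (Unique)
open import Function.Bundles using (_⇔_)
open import Relation.Binary.PropositionalEquality using (_≡_)

open import Algebra.Core using (Op₂)
open import Algebra.Structures using (IsCommutativeMonoid)
open import Data.Bool using (Bool; true; false; if_then_else_; _∧_)
import Data.Bool.Properties as BoolP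
open import Data.Fin as Fin using (zero; suc)
open import Data.Fin.Subset using (⁅_⁆; _∪_) renaming (⊥ to ∅)
open import Data.Fin.Subset.Properties using (∪-identityʳ)
open import Data.Integer as ℤ using (+_)
import Data.Integer.Properties as ℤP
open import Data.List using ([]; _∷_; _++_; map; foldr; reverse; allFin)
import Data.List.Properties as ListP
open import Data.List.Membership.Propositional using (_∉_)
import Data.List.Membership.Propositional.Properties as ∈P
open import Data.List.Membership.Propositional.Properties.WithK using (unique∧set⇒bag)
open import Data.List.Relation.Binary.BagAndSetEquality using (∼bag⇒↭)
open import Data.List.Relation.Binary.Permutation.Propositional using (↭⇒↭ₛ; ↭-sym)
open import Data.List.Relation.Binary.Permutation.Propositional.Properties using (↭-length; ↭-reverse)
import Data.List.Relation.Binary.Permutation.Propositional.Properties as ↭P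
import Data.List.Relation.Binary.Permutation.Setoid.Properties as ↭ₛP
open import Data.List.Relation.Unary.All as All using (All; [])
open import Data.List.Relation.Unary.All.Properties using (All¬⇒¬Any)
open import Data.List.Relation.Unary.Any using (here; there)
open import Data.List.Relation.Unary.Any.Properties using (reverse⁺)
open import Data.List.Relation.Unary.AllPairs using ([]; _∷_)
import Data.List.Relation.Unary.Unique.Propositional.Properties as UniqueP
open import Data.Nat as ℕ using (zero; suc; _+_; _≤_; _≤?_; _∸_; s≤s; z≤n)
import Data.Nat.Properties as ℕP
open import Data.Nat.Tactic.RingSolver using (solve-∀)
open import Data.Sum using (inj₁; inj₂)
open import Data.Product using (_×_; _,_; proj₁; proj₂; ∃)
open import Data.Rational as ℚ using (ℚ; 0ℚ; 1ℚ; toℚᵘ)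
import Data.Rational.Properties as ℚP
open import Algebra.Properties.AbelianGroup ℚP.+-0-abelianGroup using (xyx⁻¹≈y)
open import Data.Rational.Unnormalised as ℚᵘ using (mkℚᵘ; *≡*)
import Data.Rational.Unnormalised.Properties as ℚᵘP
open import Data.Vec using (Vec; _∷_; lookup; _[_]≔_)
import Data.Vec.Properties as VecP
open import Function using (_∘_)
open import Function.Bundles using (mk⇔)
import Function.Properties.Equivalence as ⇔
open import Relation.Binary.Definitions using (Trichotomous; tri<; tri≈; tri>; DecidableEquality)
open import Relation.Binary.PropositionalEquality
  using (refl; sym; trans; cong; cong₂; subst; subst₂; _≢_; setoid; module ≡-Reasoning)
open import Relation.Nullary using (¬_; Dec; yes; no; does; contradiction)
open import Relation.Nullary.Decidable using (dec-true; dec-false)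
open import Relation.Nullary.Reflects using (Reflects; ofʸ; ofⁿ; det)

infix 4 _≤⊥_ _<⊥_

data _≤⊥_ : ℤ⊥ → ℤ⊥ → Set where
  -∞≤     : ∀ {a} → -∞ ≤⊥ a
  fin≤fin : ∀ {i j} → i ℤ.≤ j → fin i ≤⊥ fin j

data _<⊥_ : ℤ⊥ → ℤ⊥ → Set where
  -∞<fin  : ∀ {j} → -∞ <⊥ fin j
  fin<fin : ∀ {i j} → i ℤ.< j → fin i <⊥ fin j

≤⊥-refl : ∀ {a} → a ≤⊥ a
≤⊥-refl { -∞}   = -∞≤
≤⊥-refl {fin i} = fin≤fin ℤP.≤-refl

≤⊥-trans : ∀ {a b c} → a ≤⊥ b → b ≤⊥ c → a ≤⊥ c
≤⊥-trans -∞≤         _           = -∞≤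
≤⊥-trans (fin≤fin p) (fin≤fin q) = fin≤fin (ℤP.≤-trans p q)

≤⊥-antisym : ∀ {a b} → a ≤⊥ b → b ≤⊥ a → a ≡ b
≤⊥-antisym -∞≤         -∞≤         = refl
≤⊥-antisym (fin≤fin p) (fin≤fin q) = cong fin (ℤP.≤-antisym p q)

fin≤fin⁻¹ : ∀ {i j} → fin i ≤⊥ fin j → i ℤ.≤ j
fin≤fin⁻¹ (fin≤fin p) = p

<⊥⇒≤⊥ : ∀ {a b} → a <⊥ b → a ≤⊥ b
<⊥⇒≤⊥ -∞<fin      = -∞≤
<⊥⇒≤⊥ (fin<fin p) = fin≤fin (ℤP.<⇒≤ p)

<⊥-irrefl : ∀ {a} → ¬ a <⊥ a
<⊥-irrefl (fin<fin p) = ℤP.<-irrefl refl p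

<⊥-≤⊥-trans : ∀ {a b c} → a <⊥ b → b ≤⊥ c → a <⊥ c
<⊥-≤⊥-trans -∞<fin      (fin≤fin _) = -∞<fin
<⊥-≤⊥-trans (fin<fin p) (fin≤fin q) = fin<fin (ℤP.<-≤-trans p q)

<⊥-cmp : Trichotomous _≡_ _<⊥_
<⊥-cmp -∞      -∞      = tri≈ <⊥-irrefl refl <⊥-irrefl
<⊥-cmp -∞      (fin _) = tri< -∞<fin (λ ()) (λ ())
<⊥-cmp (fin _) -∞      = tri> (λ ()) (λ ()) -∞<fin
<⊥-cmp (fin i) (fin j) with ℤP.<-cmp i j
... | tri< p ¬q ¬r = tri< (fin<fin p) (λ { refl → ¬q refl }) (λ { (fin<fin r) → ¬r r })
... | tri≈ ¬p q ¬r = tri≈ (λ { (fin<fin p) → ¬p p }) (cong fin q) (λ { (fin<fin r) → ¬r r })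
... | tri> ¬p ¬q r = tri> (λ { (fin<fin p) → ¬p p }) (λ { refl → ¬q refl }) (fin<fin r)

≮⊥⇒≥⊥ : ∀ {a b} → ¬ a <⊥ b → b ≤⊥ a
≮⊥⇒≥⊥ {a} {b} a≮b with <⊥-cmp a b
... | tri< a<b _ _  = contradiction a<b a≮b
... | tri≈ _ refl _ = ≤⊥-refl
... | tri> _ _ b<a  = <⊥⇒≤⊥ b<a

==⊥-reflects : ∀ a b → Reflects (a ≡ b) (a ==⊥ b)
==⊥-reflects -∞      -∞      = ofʸ refl
==⊥-reflects -∞      (fin _) = ofⁿ (λ ())
==⊥-reflects (fin _) -∞      = ofⁿ (λ ())
==⊥-reflects (fin i) (fin j) with i ℤP.≟ j
... | yes refl = ofʸ refl
... | no i≢j   = ofⁿ (λ { refl → i≢j refl })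

<⊥ᵇ-reflects : ∀ a b → Reflects (a <⊥ b) (a <⊥ᵇ b)
<⊥ᵇ-reflects -∞      -∞      = ofⁿ (λ ())
<⊥ᵇ-reflects -∞      (fin _) = ofʸ -∞<fin
<⊥ᵇ-reflects (fin _) -∞      = ofⁿ (λ ())
<⊥ᵇ-reflects (fin i) (fin j) with i ℤP.<? j
... | yes i<j = ofʸ (fin<fin i<j)
... | no i≮j  = ofⁿ (λ { (fin<fin i<j) → i≮j i<j })

==⊥-≡ : ∀ {a b} → a ≡ b → (a ==⊥ b) ≡ true
==⊥-≡ {a} {b} a≡b = det (==⊥-reflects a b) (ofʸ a≡b)

==⊥-≢ : ∀ {a b} → a ≢ b → (a ==⊥ b) ≡ false
==⊥-≢ {a} {b} a≢b = det (==⊥-reflects a b) (ofⁿ a≢b)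

<⊥ᵇ-< : ∀ {a b} → a <⊥ b → (a <⊥ᵇ b) ≡ true
<⊥ᵇ-< {a} {b} a<b = det (<⊥ᵇ-reflects a b) (ofʸ a<b)

<⊥ᵇ-≮ : ∀ {a b} → ¬ a <⊥ b → (a <⊥ᵇ b) ≡ false
<⊥ᵇ-≮ {a} {b} a≮b = det (<⊥ᵇ-reflects a b) (ofⁿ a≮b)

max⊥-< : ∀ {a b} → a <⊥ b → max⊥ a b ≡ b
max⊥-< a<b rewrite <⊥ᵇ-< a<b = refl

max⊥-≮ : ∀ {a b} → ¬ a <⊥ b → max⊥ a b ≡ a
max⊥-≮ a≮b rewrite <⊥ᵇ-≮ a≮b = refl

max⊥-≥ˡ : ∀ a b → a ≤⊥ max⊥ a b
max⊥-≥ˡ a b with <⊥-cmp a b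
... | tri< a<b _ _ = subst (a ≤⊥_) (sym (max⊥-< a<b)) (<⊥⇒≤⊥ a<b)
... | tri≈ a≮b _ _ = subst (a ≤⊥_) (sym (max⊥-≮ a≮b)) ≤⊥-refl
... | tri> a≮b _ _ = subst (a ≤⊥_) (sym (max⊥-≮ a≮b)) ≤⊥-refl

max⊥-≥ʳ : ∀ a b → b ≤⊥ max⊥ a b
max⊥-≥ʳ a b with <⊥-cmp a b
... | tri< a<b _ _ = subst (b ≤⊥_) (sym (max⊥-< a<b)) ≤⊥-refl
... | tri≈ a≮b _ _ = subst (b ≤⊥_) (sym (max⊥-≮ a≮b)) (≮⊥⇒≥⊥ a≮b)
... | tri> a≮b _ _ = subst (b ≤⊥_) (sym (max⊥-≮ a≮b)) (≮⊥⇒≥⊥ a≮b)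

+⊥-monoˡ-≤ : ∀ {a b} v → a ≤⊥ b → a +⊥ v ≤⊥ b +⊥ v
+⊥-monoˡ-≤ v -∞≤         = -∞≤
+⊥-monoˡ-≤ v (fin≤fin p) = fin≤fin (ℤP.+-monoˡ-≤ v p)

ℤ+-cancelʳ-≤ : ∀ {i j} k → i ℤ.+ k ℤ.≤ j ℤ.+ k → i ℤ.≤ j
ℤ+-cancelʳ-≤ {i} {j} k p = subst₂ ℤ._≤_ (+-k i) (+-k j) (ℤP.+-monoˡ-≤ (ℤ.- k) p)
  where
  +-k : ∀ m → m ℤ.+ k ℤ.- k ≡ m
  +-k m = trans (ℤP.+-assoc m k (ℤ.- k)) (trans (cong (ℤ._+_ m) (ℤP.+-inverseʳ k)) (ℤP.+-identityʳ m))

+⊥-cancelʳ-≤ : ∀ {a b} v → a +⊥ v ≤⊥ b +⊥ v → a ≤⊥ b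
+⊥-cancelʳ-≤ { -∞}   v _           = -∞≤
+⊥-cancelʳ-≤ {fin _} {fin _} v (fin≤fin p) = fin≤fin (ℤ+-cancelʳ-≤ v p)

+≤⇒≤∸ : ∀ m {n o} → m + n ≤ o → n ≤ o ∸ m
+≤⇒≤∸ m {n} {o} le = ℕP.m+n≤o⇒m≤o∸n n (subst (_≤ o) (ℕP.+-comm m n) le)

lookup-ext : ∀ {A : Set} {m} (u v : Vec A m) → (∀ i → lookup u i ≡ lookup v i) → u ≡ v
lookup-ext u v u≗v =
  trans (sym (VecP.tabulate∘lookup u)) (trans (VecP.tabulate-cong u≗v) (VecP.tabulate∘lookup v))

∪⁅⁆≡[]≔true : ∀ {m} (L : Subset m) x → L ∪ ⁅ x ⁆ ≡ L [ x ]≔ true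
∪⁅⁆≡[]≔true (b ∷ L) zero    = cong₂ _∷_ (BoolP.∨-zeroʳ b) (∪-identityʳ L)
∪⁅⁆≡[]≔true (b ∷ L) (suc x) = cong₂ _∷_ (BoolP.∨-identityʳ b) (∪⁅⁆≡[]≔true L x)

lookup-∪⁅⁆-≡ : ∀ {m} (L : Subset m) x → lookup (L ∪ ⁅ x ⁆) x ≡ true
lookup-∪⁅⁆-≡ L x = trans (cong (λ s → lookup s x) (∪⁅⁆≡[]≔true L x)) (VecP.lookup∘update x L true)

lookup-∪⁅⁆-≢ : ∀ {m} (L : Subset m) {x i} → i ≢ x → lookup (L ∪ ⁅ x ⁆) i ≡ lookup L i
lookup-∪⁅⁆-≢ L {x} {i} i≢x =
  trans (cong (λ s → lookup s i) (∪⁅⁆≡[]≔true L x)) (VecP.lookup∘update′ i≢x L true)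

[]≔-[]≔-lookup : ∀ {A : Set} {m} (u : Vec A m) i {a b} → lookup u i ≡ b → (u [ i ]≔ a) [ i ]≔ b ≡ u
[]≔-[]≔-lookup u i ui≡b =
  trans (VecP.[]≔-idempotent u i) (trans (cong (u [ i ]≔_) (sym ui≡b)) (VecP.[]≔-lookup u i))

∈-map-[]≔ : ∀ {A : Set} {m} (u : Vec A m) i {a b} {us} → lookup u i ≡ b → u [ i ]≔ a ∈ us →
            u ∈ map (_[ i ]≔ b) us
∈-map-[]≔ u i ui≡b u′∈us = subst (_∈ _) ([]≔-[]≔-lookup u i ui≡b) (∈P.∈-map⁺ (_[ i ]≔ _) u′∈us)

unique-map-[]≔ : ∀ {A : Set} {m} i {a b} {us : List (Vec A m)} → All (λ u → lookup u i ≡ b) us → Unique us →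
                 Unique (map (_[ i ]≔ a) us)
unique-map-[]≔ i {a} {b} {us} all≡b unique-us = UniqueP.map⁻ (subst Unique (sym restore) unique-us)
  where
  restore : map (_[ i ]≔ b) (map (_[ i ]≔ a) us) ≡ us
  restore = trans (sym (ListP.map-∘ us)) (ListP.map-id-local (All.map (λ {u} → []≔-[]≔-lookup u i) all≡b))

true≢false : true ≢ false
true≢false ()

false∧ : ∀ {a b} → a ≡ false → a ∧ b ≡ false
false∧ refl = refl

if-true : ∀ {A : Set} {b} {x y : A} → b ≡ true → (if b then x else y) ≡ x
if-true refl = refl

if-false : ∀ {A : Set} {b} {x y : A} → b ≡ false → (if b then x else y) ≡ y
if-false refl = refl

foldr-reverse : ∀ {A M : Set} {_∙_ : Op₂ M} {ε : M} → IsCommutativeMonoid _≡_ _∙_ ε → ∀ (f : A → M) xs →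
                foldr (λ a acc → f a ∙ acc) ε (reverse xs) ≡ foldr (λ a acc → f a ∙ acc) ε xs
foldr-reverse {M = M} {_∙_} {ε} isCM f xs = begin
  foldr (λ a acc → f a ∙ acc) ε (reverse xs) ≡⟨ ListP.foldr-map _∙_ f ε (reverse xs) ⟨
  foldr _∙_ ε (map f (reverse xs))
    ≡⟨ ↭ₛP.foldr-commMonoid (setoid M) isCM (↭⇒↭ₛ (↭P.map⁺ f (↭-reverse xs))) ⟩
  foldr _∙_ ε (map f xs)                      ≡⟨ ListP.foldr-map _∙_ f ε xs ⟩
  foldr (λ a acc → f a ∙ acc) ε xs            ∎
  where open ≡-Reasoning

unique-reverse : ∀ {A : Set} {xs : List A} → Unique xs → Unique (reverse xs)
unique-reverse {A} {xs} = ↭ₛP.Unique-resp-↭ (setoid A) (↭⇒↭ₛ (↭-sym (↭-reverse xs)))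

length-unique-≡ : ∀ {A : Set} {xs ys : List A} → Unique xs → Unique ys → (∀ {a} → a ∈ xs ⇔ a ∈ ys) →
                  length xs ≡ length ys
length-unique-≡ u v xs⇔ys = ↭-length (∼bag⇒↭ (unique∧set⇒bag u v xs⇔ys))

∈-nonempty : ∀ {A : Set} (xs : List A) → 0 < length xs → ∃ (_∈ xs)
∈-nonempty (x ∷ _) _ = x , here refl

private
  ratio-≃ : ∀ a d → toℚᵘ (ratio a (suc d)) ℚᵘ.≃ mkℚᵘ (+ a) d
  ratio-≃ a d = ℚP.toℚᵘ-fromℚᵘ (mkℚᵘ (+ a) d)

-- holds for d = 0 too, since ratio and inv return 0ℚ there
ratio-*-inv : ∀ {a} d → 0 < a → ratio a d ℚ.* inv a ≡ inv d
ratio-*-inv {suc a} zero    _ = ℚP.*-zeroˡ (inv (suc a))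
ratio-*-inv {suc a} (suc d) _ = ℚP.toℚᵘ-injective (begin
  toℚᵘ (ratio (suc a) (suc d) ℚ.* inv (suc a))
    ≈⟨ ℚP.toℚᵘ-homo-* (ratio (suc a) (suc d)) (inv (suc a)) ⟩
  toℚᵘ (ratio (suc a) (suc d)) ℚᵘ.* toℚᵘ (inv (suc a))
    ≈⟨ ℚᵘP.*-cong (ratio-≃ (suc a) d) (ratio-≃ 1 a) ⟩
  mkℚᵘ (+ suc a) d ℚᵘ.* mkℚᵘ (+ 1) a
    ≈⟨ *≡* (cong (+_) (cross-multiplied a d)) ⟩
  mkℚᵘ (+ 1) d
    ≈⟨ ratio-≃ 1 d ⟨
  toℚᵘ (inv (suc d)) ∎)
  where
  open ℚᵘP.≃-Reasoning
  cross-multiplied : ∀ a d → (suc a ℕ.* 1) ℕ.* suc d ≡ 1 ℕ.* suc (a + d ℕ.* suc a)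
  cross-multiplied = solve-∀

ratio-+-ratio : ∀ a b → 0 < a → 0 < b → ratio a (b + a) ℚ.+ ratio b (b + a) ≡ 1ℚ
ratio-+-ratio (suc a) (suc b) _ _ = ℚP.toℚᵘ-injective (begin
  toℚᵘ (ratio (suc a) D ℚ.+ ratio (suc b) D)
    ≈⟨ ℚP.toℚᵘ-homo-+ (ratio (suc a) D) (ratio (suc b) D) ⟩
  toℚᵘ (ratio (suc a) D) ℚᵘ.+ toℚᵘ (ratio (suc b) D)
    ≈⟨ ℚᵘP.+-cong (ratio-≃ (suc a) (b + suc a)) (ratio-≃ (suc b) (b + suc a)) ⟩
  mkℚᵘ (+ suc a) (b + suc a) ℚᵘ.+ mkℚᵘ (+ suc b) (b + suc a)
    ≈⟨ *≡* (cong (+_) (cross-multiplied a b)) ⟩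
  toℚᵘ 1ℚ ∎)
  where
  open ℚᵘP.≃-Reasoning
  D : ℕ
  D = suc b + suc a
  cross-multiplied : ∀ a b → (suc a ℕ.* suc (b + suc a) + suc b ℕ.* suc (b + suc a)) ℕ.* 1
                             ≡ 1 ℕ.* (suc (b + suc a) ℕ.* suc (b + suc a))
  cross-multiplied = solve-∀

1-ratio : ∀ a b → 0 < a → 0 < b → 1ℚ ℚ.- ratio a (b + a) ≡ ratio b (b + a)
1-ratio a b 0<a 0<b = begin
  1ℚ ℚ.- ratio a (b + a)
    ≡⟨ cong (ℚ._- ratio a (b + a)) (ratio-+-ratio a b 0<a 0<b) ⟨
  ratio a (b + a) ℚ.+ ratio b (b + a) ℚ.- ratio a (b + a)
    ≡⟨ xyx⁻¹≈y (ratio a (b + a)) (ratio b (b + a)) ⟩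
  ratio b (b + a) ∎
  where open ≡-Reasoning

module Mass {A : Set} (_≟_ : DecidableEquality A) where

  mass-at : A × ℚ → A → ℚ
  mass-at p a = if does (proj₁ p ≟ a) then proj₂ p else 0ℚ

  mass : Dist A → A → ℚ
  mass d a = foldr (λ p acc → mass-at p a ℚ.+ acc) 0ℚ d

  mass-++ : ∀ d e a → mass (d ++ e) a ≡ mass d a ℚ.+ mass e a
  mass-++ []      e a = sym (ℚP.+-identityˡ (mass e a))
  mass-++ (p ∷ d) e a =
    trans (cong (ℚ._+_ (mass-at p a)) (mass-++ d e a)) (sym (ℚP.+-assoc (mass-at p a) (mass d a) (mass e a)))

  mass-scale : ∀ c d a → mass (map (λ p → proj₁ p , c ℚ.* proj₂ p) d) a ≡ c ℚ.* mass d a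
  mass-scale c []            a = sym (ℚP.*-zeroʳ c)
  mass-scale c ((b , r) ∷ d) a =
    trans (cong₂ ℚ._+_ (scale-if (does (b ≟ a))) (mass-scale c d a)) (sym (ℚP.*-distribˡ-+ c _ (mass d a)))
    where
    scale-if : ∀ e → (if e then c ℚ.* r else 0ℚ) ≡ c ℚ.* (if e then r else 0ℚ)
    scale-if true  = refl
    scale-if false = sym (ℚP.*-zeroʳ c)

  mass-bernoulli : ∀ q (d₁ d₂ : Dist A) a →
                   mass (bernoulli q >>= λ r → if r then d₁ else d₂) a
                   ≡ q ℚ.* mass d₁ a ℚ.+ (1ℚ ℚ.- q) ℚ.* mass d₂ a
  mass-bernoulli q d₁ d₂ a = begin
    mass (heads ++ tails ++ []) a         ≡⟨ mass-++ heads (tails ++ []) a ⟩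
    mass heads a ℚ.+ mass (tails ++ []) a ≡⟨ cong (λ d → mass heads a ℚ.+ mass d a) (ListP.++-identityʳ tails) ⟩
    mass heads a ℚ.+ mass tails a         ≡⟨ cong₂ ℚ._+_ (mass-scale q d₁ a) (mass-scale (1ℚ ℚ.- q) d₂ a) ⟩
    q ℚ.* mass d₁ a ℚ.+ (1ℚ ℚ.- q) ℚ.* mass d₂ a ∎
    where
    open ≡-Reasoning
    heads tails : Dist A
    heads = map (λ p → proj₁ p , q ℚ.* proj₂ p) d₁
    tails = map (λ p → proj₁ p , (1ℚ ℚ.- q) ℚ.* proj₂ p) d₂

  mass-return-≡ : ∀ a → mass (return a) a ≡ 1ℚ
  mass-return-≡ a rewrite dec-true (a ≟ a) refl = ℚP.+-identityʳ 1ℚ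

  mass-return-≢ : ∀ {b a} → b ≢ a → mass (return b) a ≡ 0ℚ
  mass-return-≢ {b} {a} b≢a rewrite dec-false (b ≟ a) b≢a = ℚP.+-identityʳ 0ℚ

  mass-branch-≡0 : ∀ b c q (d₁ d₂ : Dist A) a → mass d₁ a ≡ 0ℚ → mass d₂ a ≡ 0ℚ →
                   mass (if b then (bernoulli q >>= λ r → if r then d₁ else d₂) else if c then d₁ else d₂) a ≡ 0ℚ
  mass-branch-≡0 true  _     q d₁ d₂ a z₁ z₂ = begin
    mass (bernoulli q >>= λ r → if r then d₁ else d₂) a
      ≡⟨ mass-bernoulli q d₁ d₂ a ⟩
    q ℚ.* mass d₁ a ℚ.+ (1ℚ ℚ.- q) ℚ.* mass d₂ a
      ≡⟨ cong₂ (λ u v → q ℚ.* u ℚ.+ (1ℚ ℚ.- q) ℚ.* v) z₁ z₂ ⟩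
    q ℚ.* 0ℚ ℚ.+ (1ℚ ℚ.- q) ℚ.* 0ℚ
      ≡⟨ cong₂ ℚ._+_ (ℚP.*-zeroʳ q) (ℚP.*-zeroʳ (1ℚ ℚ.- q)) ⟩
    0ℚ ∎
    where open ≡-Reasoning
  mass-branch-≡0 false true  q d₁ d₂ a z₁ z₂ = z₁
  mass-branch-≡0 false false q d₁ d₂ a z₁ z₂ = z₂

module _ {n : ℕ} (wt : Fin n → ℕ) (val : Fin n → ℤ) (W : ℕ) where
  open Knapsack wt val W
  open Mass (VecP.≡-dec {n = n} BoolP._≟_)
  open import Data.List.Membership.DecPropositional (Fin._≟_ {n}) using (_∈?_)

  weightOn : List (Fin n) → Subset n → ℕ
  weightOn xs t = foldr (λ i acc → (if lookup t i then wt i else 0) + acc) 0 xs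

  valueOn : List (Fin n) → Subset n → ℤ
  valueOn xs t = foldr (λ i acc → (if lookup t i then val i else + 0) ℤ.+ acc) (+ 0) xs

  weightOn-∷-∉ : ∀ {t : Subset n} {x} xs → lookup t x ≡ false → weightOn (x ∷ xs) t ≡ weightOn xs t
  weightOn-∷-∉ xs tx rewrite tx = refl

  weightOn-∷-∈ : ∀ {t : Subset n} {x} xs → lookup t x ≡ true → weightOn (x ∷ xs) t ≡ wt x + weightOn xs t
  weightOn-∷-∈ xs tx rewrite tx = refl

  valueOn-∷-∉ : ∀ {t : Subset n} {x} xs → lookup t x ≡ false → valueOn (x ∷ xs) t ≡ valueOn xs t
  valueOn-∷-∉ xs tx rewrite tx = ℤP.+-identityˡ _

  valueOn-∷-∈ : ∀ {t : Subset n} {x} xs → lookup t x ≡ true → valueOn (x ∷ xs) t ≡ valueOn xs t ℤ.+ val x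
  valueOn-∷-∈ {x = x} xs tx rewrite tx = ℤP.+-comm (val x) _

  weightOn-cong : ∀ xs {s t : Subset n} → (∀ {i} → i ∈ xs → lookup s i ≡ lookup t i) →
                  weightOn xs s ≡ weightOn xs t
  weightOn-cong []       _   = refl
  weightOn-cong (x ∷ xs) {s} {t} s≗t =
    cong₂ _+_ (cong (λ b → if b then wt x else 0) (s≗t (here refl))) (weightOn-cong xs {s} {t} (s≗t ∘ there))

  valueOn-cong : ∀ xs {s t : Subset n} → (∀ {i} → i ∈ xs → lookup s i ≡ lookup t i) →
                 valueOn xs s ≡ valueOn xs t
  valueOn-cong []       _   = refl
  valueOn-cong (x ∷ xs) {s} {t} s≗t =
    cong₂ ℤ._+_ (cong (λ b → if b then val x else + 0) (s≗t (here refl))) (valueOn-cong xs {s} {t} (s≗t ∘ there))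

  weightOn≤0⇒∉ : (∀ i → 0 < wt i) → ∀ xs {t : Subset n} {i} → weightOn xs t ≤ 0 → i ∈ xs →
                 lookup t i ≡ false
  weightOn≤0⇒∉ pos (x ∷ xs) {t} le i∈ with lookup t x in tx | i∈
  ... | true  | _          = contradiction (ℕP.m+n≤o⇒m≤o (wt x) le) (ℕP.<⇒≱ (pos x))
  ... | false | here refl  = tx
  ... | false | there i∈xs = weightOn≤0⇒∉ pos xs {t} le i∈xs

  record OptimalOn (xs : List (Fin n)) (w : ℕ) (t : Subset n) : Set where
    constructor optimalOn
    field
      feasible : weightOn xs t ≤ w
      attains  : fin (valueOn xs t) ≡ V xs w

  record Within (xs : List (Fin n)) (t : Subset n) : Set where
    constructor within
    field
      outside : ∀ {i} → i ∉ xs → lookup t i ≡ false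

  OptimalOn-[]≔ : ∀ {xs w} {t : Subset n} {x} b → x ∉ xs → OptimalOn xs w t → OptimalOn xs w (t [ x ]≔ b)
  OptimalOn-[]≔ {xs} {w} {t} {x} b x∉xs (optimalOn le eq) =
    optimalOn (subst (_≤ w) (sym (weightOn-cong xs {t′} {t} unchanged)) le)
              (trans (cong fin (valueOn-cong xs {t′} {t} unchanged)) eq)
    where
    t′ : Subset n
    t′ = t [ x ]≔ b
    unchanged : ∀ {i} → i ∈ xs → lookup t′ i ≡ lookup t i
    unchanged i∈xs = VecP.lookup∘update′ (λ { refl → x∉xs i∈xs }) t b

  V-skip-≤ : ∀ xs x w → V xs w ≤⊥ V (x ∷ xs) w
  V-skip-≤ xs x w = max⊥-≥ˡ _ _

  V-take-≤ : ∀ xs x {w} → wt x ≤ w → V xs (w ∸ wt x) +⊥ val x ≤⊥ V (x ∷ xs) w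
  V-take-≤ xs x {w} x≤w with wt x ≤? w
  ... | yes _  = max⊥-≥ʳ (V xs w) _
  ... | no x≰w = contradiction x≤w x≰w

  -∞<V : ∀ xs w → -∞ <⊥ V xs w
  -∞<V []       w = -∞<fin
  -∞<V (x ∷ xs) w = <⊥-≤⊥-trans (-∞<V xs w) (V-skip-≤ xs x w)

  valueOn≤V : ∀ xs w t → weightOn xs t ≤ w → fin (valueOn xs t) ≤⊥ V xs w
  valueOn≤V []       w t _  = ≤⊥-refl
  valueOn≤V (x ∷ xs) w t le with lookup t x
  ... | false = subst (_≤⊥ V (x ∷ xs) w) (cong fin (sym (ℤP.+-identityˡ _)))
                  (≤⊥-trans (valueOn≤V xs w t le) (V-skip-≤ xs x w))
  ... | true  = subst (_≤⊥ V (x ∷ xs) w) (cong fin (ℤP.+-comm _ (val x)))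
                  (≤⊥-trans (+⊥-monoˡ-≤ (val x) (valueOn≤V xs (w ∸ wt x) t (+≤⇒≤∸ (wt x) le)))
                            (V-take-≤ xs x (ℕP.m+n≤o⇒m≤o (wt x) le)))

  -- The three cases of the recurrences for v = V(i,w) and c = C(i,w).  Taking v and c as parameters
  -- lets `choice` unfold them by matching on wt x ≤? w, the test Vsub and Csub are defined by.
  data Choice (xs : List (Fin n)) (x : Fin n) (w : ℕ) (v : ℤ⊥) (c : ℕ) : Set where
    both : wt x ≤ w → V xs w ≡ V xs (w ∸ wt x) +⊥ val x →
           v ≡ V xs w → c ≡ C xs w + C xs (w ∸ wt x) → Choice xs x w v c
    skip : (wt x ≤ w → V xs (w ∸ wt x) +⊥ val x <⊥ V xs w) →
           v ≡ V xs w → c ≡ C xs w → Choice xs x w v c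
    take : wt x ≤ w → V xs w <⊥ V xs (w ∸ wt x) +⊥ val x →
           v ≡ V xs (w ∸ wt x) +⊥ val x → c ≡ C xs (w ∸ wt x) → Choice xs x w v c

  choice : ∀ xs x w → Choice xs x w (V (x ∷ xs) w) (C (x ∷ xs) w)
  choice xs x w with wt x ≤? w
  ... | no x≰w
    rewrite ==⊥-≢ (λ V≡-∞ → <⊥-irrefl (subst (-∞ <⊥_) V≡-∞ (-∞<V xs w))) | <⊥ᵇ-< (-∞<V xs w)
    = skip (λ x≤w → contradiction x≤w x≰w) (max⊥-≮ λ ()) refl
  ... | yes x≤w with <⊥-cmp (V xs w) (V xs (w ∸ wt x) +⊥ val x)
  ...   | tri< V<S V≢S S≮V rewrite ==⊥-≢ V≢S | <⊥ᵇ-≮ S≮V = take x≤w V<S (max⊥-< V<S) refl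
  ...   | tri≈ V≮S V≡S _   rewrite ==⊥-≡ V≡S = both x≤w V≡S (max⊥-≮ V≮S) refl
  ...   | tri> V≮S V≢S S<V rewrite ==⊥-≢ V≢S | <⊥ᵇ-< S<V = skip (λ _ → S<V) (max⊥-≮ V≮S) refl

  C-pos : ∀ xs w → 0 < C xs w
  C-pos []       w = s≤s z≤n
  C-pos (x ∷ xs) w with choice xs x w
  ... | both _ _ _ c≡ = subst (0 <_) (sym c≡) (ℕP.<-≤-trans (C-pos xs w) (ℕP.m≤m+n _ _))
  ... | skip _ _ c≡   = subst (0 <_) (sym c≡) (C-pos xs w)
  ... | take _ _ _ c≡ = subst (0 <_) (sym c≡) (C-pos xs (w ∸ wt x))

  C-zero : (∀ i → 0 < wt i) → ∀ xs → C xs 0 ≡ 1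
  C-zero pos []       = refl
  C-zero pos (x ∷ xs) with choice xs x 0
  ... | both x≤0 _ _ _ = contradiction x≤0 (ℕP.<⇒≱ (pos x))
  ... | skip _ _ c≡    = trans c≡ (C-zero pos xs)
  ... | take x≤0 _ _ _ = contradiction x≤0 (ℕP.<⇒≱ (pos x))

  OptimalOn-∷-∉⁻ : ∀ {xs x w} {t : Subset n} → lookup t x ≡ false → OptimalOn (x ∷ xs) w t →
                   OptimalOn xs w t × V (x ∷ xs) w ≡ V xs w
  OptimalOn-∷-∉⁻ {xs} {x} {w} {t} tx (optimalOn le eq) = optimalOn le′ (sym V≡) , trans (sym eq′) (sym V≡)
    where
    le′ : weightOn xs t ≤ w
    le′ = subst (_≤ w) (weightOn-∷-∉ {t} xs tx) le
    eq′ : fin (valueOn xs t) ≡ V (x ∷ xs) w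
    eq′ = trans (cong fin (sym (valueOn-∷-∉ {t} xs tx))) eq
    V≡ : V xs w ≡ fin (valueOn xs t)
    V≡ = ≤⊥-antisym (subst (V xs w ≤⊥_) (sym eq′) (V-skip-≤ xs x w)) (valueOn≤V xs w t le′)

  OptimalOn-∷-∈⁻ : ∀ {xs x w} {t : Subset n} → lookup t x ≡ true → OptimalOn (x ∷ xs) w t →
                   wt x ≤ w × OptimalOn xs (w ∸ wt x) t × V (x ∷ xs) w ≡ V xs (w ∸ wt x) +⊥ val x
  OptimalOn-∷-∈⁻ {xs} {x} {w} {t} tx (optimalOn le eq) =
    x≤w , optimalOn le′ (sym V≡) , trans (sym eq′) (cong (_+⊥ val x) (sym V≡))
    where
    le″ : wt x + weightOn xs t ≤ w
    le″ = subst (_≤ w) (weightOn-∷-∈ {t} xs tx) le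
    x≤w : wt x ≤ w
    x≤w = ℕP.m+n≤o⇒m≤o (wt x) le″
    le′ : weightOn xs t ≤ w ∸ wt x
    le′ = +≤⇒≤∸ (wt x) le″
    eq′ : fin (valueOn xs t) +⊥ val x ≡ V (x ∷ xs) w
    eq′ = trans (cong fin (sym (valueOn-∷-∈ {t} xs tx))) eq
    V≡ : V xs (w ∸ wt x) ≡ fin (valueOn xs t)
    V≡ = ≤⊥-antisym
           (+⊥-cancelʳ-≤ (val x) (subst (V xs (w ∸ wt x) +⊥ val x ≤⊥_) (sym eq′) (V-take-≤ xs x x≤w)))
           (valueOn≤V xs (w ∸ wt x) t le′)

  OptimalOn-∷-∉⁺ : ∀ {xs x w} {t : Subset n} → lookup t x ≡ false → OptimalOn xs w t →
                   V (x ∷ xs) w ≡ V xs w → OptimalOn (x ∷ xs) w t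
  OptimalOn-∷-∉⁺ {xs} {w = w} {t} tx (optimalOn le eq) V≡ =
    optimalOn (subst (_≤ w) (sym (weightOn-∷-∉ {t} xs tx)) le)
              (trans (cong fin (valueOn-∷-∉ {t} xs tx)) (trans eq (sym V≡)))

  OptimalOn-∷-∈⁺ : ∀ {xs x w} {t : Subset n} → lookup t x ≡ true → wt x ≤ w → OptimalOn xs (w ∸ wt x) t →
                   V (x ∷ xs) w ≡ V xs (w ∸ wt x) +⊥ val x → OptimalOn (x ∷ xs) w t
  OptimalOn-∷-∈⁺ {xs} {x} {w} {t} tx x≤w (optimalOn le eq) V≡ =
    optimalOn (subst (_≤ w) (sym (weightOn-∷-∈ {t} xs tx)) fits)
              (trans (cong fin (valueOn-∷-∈ {t} xs tx)) (trans (cong (_+⊥ val x) eq) (sym V≡)))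
    where
    fits : wt x + weightOn xs t ≤ w
    fits = subst (wt x + weightOn xs t ≤_) (ℕP.m+[n∸m]≡n x≤w) (ℕP.+-monoʳ-≤ (wt x) le)

  Within-∷⁺ : ∀ {xs x} {s : Subset n} → Within xs s → Within (x ∷ xs) s
  Within-∷⁺ (within out) = within (out ∘ (_∘ there))

  Within-∷⁻ : ∀ {xs x} {s : Subset n} → lookup s x ≡ false → Within (x ∷ xs) s → Within xs s
  Within-∷⁻ {xs} {x} {s} sx (within out) = within out′
    where
    out′ : ∀ {i} → i ∉ xs → lookup s i ≡ false
    out′ {i} i∉xs with i Fin.≟ x
    ... | yes refl = sx
    ... | no i≢x   = out (λ { (here i≡x) → i≢x i≡x ; (there i∈xs) → i∉xs i∈xs })

  Within-[]≔ : ∀ {xs x} {s : Subset n} b → Within (x ∷ xs) s → Within (x ∷ xs) (s [ x ]≔ b)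
  Within-[]≔ {s = s} b (within out) =
    within λ i∉ → trans (VecP.lookup∘update′ (λ { refl → i∉ (here refl) }) s b) (out i∉)

  OptimalWithin : List (Fin n) → ℕ → Subset n → Set
  OptimalWithin xs w s = Within xs s × OptimalOn xs w s

  OptimalWithin-∷-∉⁺ : ∀ {xs x w} {s : Subset n} → x ∉ xs → OptimalWithin xs w s →
                       V (x ∷ xs) w ≡ V xs w → OptimalWithin (x ∷ xs) w s
  OptimalWithin-∷-∉⁺ x∉xs (wi , opt) V≡ = Within-∷⁺ wi , OptimalOn-∷-∉⁺ (Within.outside wi x∉xs) opt V≡

  OptimalWithin-∷-∈⁺ : ∀ {xs x w} {s : Subset n} → x ∉ xs → wt x ≤ w → OptimalWithin xs (w ∸ wt x) s →
                       V (x ∷ xs) w ≡ V xs (w ∸ wt x) +⊥ val x → OptimalWithin (x ∷ xs) w (s [ x ]≔ true)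
  OptimalWithin-∷-∈⁺ {x = x} {s = s} x∉xs x≤w (wi , opt) V≡ =
    Within-[]≔ true (Within-∷⁺ wi) ,
    OptimalOn-∷-∈⁺ (VecP.lookup∘update x s true) x≤w (OptimalOn-[]≔ true x∉xs opt) V≡

  optimals : List (Fin n) → ℕ → List (Subset n)
  optimals []       w = ∅ ∷ []
  optimals (x ∷ xs) w with choice xs x w
  ... | both _ _ _ _ = optimals xs w ++ map (_[ x ]≔ true) (optimals xs (w ∸ wt x))
  ... | skip _ _ _   = optimals xs w
  ... | take _ _ _ _ = map (_[ x ]≔ true) (optimals xs (w ∸ wt x))

  length-optimals : ∀ xs w → length (optimals xs w) ≡ C xs w
  length-optimals []       w = refl
  length-optimals (x ∷ xs) w with choice xs x w
  ... | both _ _ _ c≡ = trans (ListP.length-++ (optimals xs w))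
                          (trans (cong₂ _+_ (length-optimals xs w) (length-with-x)) (sym c≡))
    where
    length-with-x : length (map (_[ x ]≔ true) (optimals xs (w ∸ wt x))) ≡ C xs (w ∸ wt x)
    length-with-x = trans (ListP.length-map _ (optimals xs (w ∸ wt x))) (length-optimals xs (w ∸ wt x))
  ... | skip _ _ c≡   = trans (length-optimals xs w) (sym c≡)
  ... | take _ _ _ c≡ = trans (ListP.length-map _ (optimals xs (w ∸ wt x)))
                          (trans (length-optimals xs (w ∸ wt x)) (sym c≡))

  optimals-sound : ∀ {xs w} {s : Subset n} → Unique xs → s ∈ optimals xs w → OptimalWithin xs w s
  optimals-sound {[]} _ (here refl) = within (λ {i} _ → VecP.lookup-replicate i false) , optimalOn z≤n refl
  optimals-sound {x ∷ xs} {w} {s} (x∉ ∷ u) s∈ with choice xs x w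
  ... | both x≤w tie v≡ _ with ∈P.∈-++⁻ (optimals xs w) s∈
  ...   | inj₁ s∈₁ = OptimalWithin-∷-∉⁺ (All¬⇒¬Any x∉) (optimals-sound u s∈₁) v≡
  ...   | inj₂ s∈₂ with ∈P.∈-map⁻ (_[ x ]≔ true) s∈₂
  ...     | s′ , s′∈ , refl = OptimalWithin-∷-∈⁺ (All¬⇒¬Any x∉) x≤w (optimals-sound u s′∈) (trans v≡ tie)
  optimals-sound {x ∷ xs} {w} {s} (x∉ ∷ u) s∈ | skip _ v≡ _ =
    OptimalWithin-∷-∉⁺ (All¬⇒¬Any x∉) (optimals-sound u s∈) v≡
  optimals-sound {x ∷ xs} {w} {s} (x∉ ∷ u) s∈ | take x≤w _ v≡ _ with ∈P.∈-map⁻ (_[ x ]≔ true) s∈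
  ... | s′ , s′∈ , refl = OptimalWithin-∷-∈⁺ (All¬⇒¬Any x∉) x≤w (optimals-sound u s′∈) v≡

  optimals-complete : ∀ {xs w} {s : Subset n} → Unique xs → Within xs s → OptimalOn xs w s → s ∈ optimals xs w
  optimals-complete {[]} {s = s} _ (within out) _ =
    here (lookup-ext s ∅ λ i → trans (out λ ()) (sym (VecP.lookup-replicate i false)))
  optimals-complete {x ∷ xs} {w} {s} (x∉ ∷ u) wi opt with lookup s x BoolP.≟ true | choice xs x w
  ... | yes sx | c with OptimalOn-∷-∈⁻ sx opt
  ...   | x≤w , opt′ , V≡
    with c | optimals-complete u (Within-∷⁻ (VecP.lookup∘update x s false) (Within-[]≔ false wi))
                                 (OptimalOn-[]≔ false (All¬⇒¬Any x∉) opt′)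
  ...     | both _ _ _ _    | s′∈ = ∈P.∈-++⁺ʳ (optimals xs w) (∈-map-[]≔ s x sx s′∈)
  ...     | take _ _ _ _    | s′∈ = ∈-map-[]≔ s x sx s′∈
  ...     | skip below v≡ _ | _   =
    contradiction (subst (V xs (w ∸ wt x) +⊥ val x <⊥_) (trans (sym v≡) V≡) (below x≤w)) <⊥-irrefl
  optimals-complete {x ∷ xs} {w} {s} (x∉ ∷ u) wi opt | no ¬sx | c with OptimalOn-∷-∉⁻ (BoolP.¬-not ¬sx) opt
  ... | opt′ , V≡ with c | optimals-complete u (Within-∷⁻ (BoolP.¬-not ¬sx) wi) opt′
  ...   | both _ _ _ _    | s∈ = ∈P.∈-++⁺ˡ s∈
  ...   | skip _ _ _      | s∈ = s∈
  ...   | take _ V<S v≡ _ | _  = contradiction (subst (V xs w <⊥_) (trans (sym v≡) V≡) V<S) <⊥-irrefl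

  optimals-∌ : ∀ {xs w x} {s : Subset n} → Unique xs → x ∉ xs → s ∈ optimals xs w → lookup s x ≡ false
  optimals-∌ u x∉xs s∈ = Within.outside (proj₁ (optimals-sound u s∈)) x∉xs

  optimals-unique : ∀ xs w → Unique xs → Unique (optimals xs w)
  optimals-unique []       w _        = [] ∷ []
  optimals-unique (x ∷ xs) w (x∉ ∷ u) with choice xs x w
  ... | skip _ _ _   = optimals-unique xs w u
  ... | take _ _ _ _ = unique-map-[]≔ x (All.tabulate (optimals-∌ u (All¬⇒¬Any x∉))) (optimals-unique xs _ u)
  ... | both _ _ _ _ = UniqueP.++⁺ (optimals-unique xs w u)
                         (unique-map-[]≔ x (All.tabulate (optimals-∌ u (All¬⇒¬Any x∉))) (optimals-unique xs _ u))
                         disjoint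
    where
    disjoint : ∀ {s} → ¬ (s ∈ optimals xs w × s ∈ map (_[ x ]≔ true) (optimals xs (w ∸ wt x)))
    disjoint (s∈₁ , s∈₂) with ∈P.∈-map⁻ (_[ x ]≔ true) s∈₂
    ... | s′ , _ , refl = true≢false (trans (sym (VecP.lookup∘update x s′ true)) (optimals-∌ u (All¬⇒¬Any x∉) s∈₁))

  OptimalOn-exists : ∀ xs w → Unique xs → ∃ (OptimalOn xs w)
  OptimalOn-exists xs w u =
    let g , g∈ = ∈-nonempty (optimals xs w) (subst (0 <_) (sym (length-optimals xs w)) (C-pos xs w))
    in  g , proj₂ (optimals-sound u g∈)

  tie-test : List (Fin n) → Fin n → ℕ → Bool
  tie-test xs x w =
    does (wt x ≤? w) ∧ (V (x ∷ xs) w ==⊥ V xs w) ∧ (V (x ∷ xs) w ==⊥ (V xs (w ∸ wt x) +⊥ val x))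

  no-tie : ∀ xs x w → (wt x ≤ w → V xs (w ∸ wt x) +⊥ val x <⊥ V xs w) → V (x ∷ xs) w ≡ V xs w →
           tie-test xs x w ≡ false
  no-tie xs x w below v≡ with wt x ≤? w
  ... | no x≰w  = false∧ (dec-false (wt x ≤? w) x≰w)
  ... | yes x≤w = cong₂ _∧_ (dec-true (wt x ≤? w) x≤w) (cong₂ _∧_ (==⊥-≡ v≡) (==⊥-≢ λ v≡S →
                    <⊥-irrefl (subst (_<⊥ V xs w) (trans (sym v≡S) v≡) (below x≤w))))

  loop-both : ∀ xs x k L → wt x ≤ suc k → V xs (suc k) ≡ V xs (suc k ∸ wt x) +⊥ val x →
              V (x ∷ xs) (suc k) ≡ V xs (suc k) →
              loop (x ∷ xs) (suc k) L ≡ (bernoulli (ratio (C xs (suc k ∸ wt x)) (C (x ∷ xs) (suc k))) >>= λ r →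
                                          if r then loop xs (suc k ∸ wt x) (L ∪ ⁅ x ⁆) else loop xs (suc k) L)
  loop-both xs x k L x≤w tie v≡ =
    if-true (cong₂ _∧_ (dec-true (wt x ≤? suc k) x≤w) (cong₂ _∧_ (==⊥-≡ v≡) (==⊥-≡ (trans v≡ tie))))

  loop-skip : ∀ xs x k L → (wt x ≤ suc k → V xs (suc k ∸ wt x) +⊥ val x <⊥ V xs (suc k)) →
              V (x ∷ xs) (suc k) ≡ V xs (suc k) → loop (x ∷ xs) (suc k) L ≡ loop xs (suc k) L
  loop-skip xs x k L below v≡ =
    trans (if-false (no-tie xs x (suc k) below v≡))
          (if-false (<⊥ᵇ-≮ (<⊥-irrefl ∘ subst (V xs (suc k) <⊥_) v≡)))

  loop-take : ∀ xs x k L → V xs (suc k) <⊥ V (x ∷ xs) (suc k) →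
              loop (x ∷ xs) (suc k) L ≡ loop xs (suc k ∸ wt x) (L ∪ ⁅ x ⁆)
  loop-take xs x k L V<v = trans (if-false no-coin) (if-true (<⊥ᵇ-< V<v))
    where
    no-coin : tie-test xs x (suc k) ≡ false
    no-coin = trans (cong (does (wt x ≤? suc k) ∧_) (false∧ (==⊥-≢ v≢V))) (BoolP.∧-zeroʳ (does (wt x ≤? suc k)))
      where
      v≢V : V (x ∷ xs) (suc k) ≢ V xs (suc k)
      v≢V v≡V = <⊥-irrefl (subst (V xs (suc k) <⊥_) v≡V V<v)

  -- the invariant of the procedure: t is L plus some of the items xs still to be decided
  record Extends (xs : List (Fin n)) (L t : Subset n) : Set where
    constructor extends
    field
      agree : ∀ {i} → i ∉ xs → lookup t i ≡ lookup L i
      fresh : ∀ {i} → i ∈ xs → lookup L i ≡ false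

  Extends-[] : ∀ {L t} → Extends [] L t → t ≡ L
  Extends-[] {L} {t} (extends agree _) = lookup-ext t L λ _ → agree λ ()

  Extends-take : ∀ {xs x L t} → x ∉ xs → lookup t x ≡ true → Extends (x ∷ xs) L t →
                 Extends xs (L ∪ ⁅ x ⁆) t
  Extends-take {xs} {x} {L} {t} x∉xs tx (extends agree fresh) = extends agree′ fresh′
    where
    agree′ : ∀ {i} → i ∉ xs → lookup t i ≡ lookup (L ∪ ⁅ x ⁆) i
    agree′ {i} i∉xs with i Fin.≟ x
    ... | yes refl = trans tx (sym (lookup-∪⁅⁆-≡ L x))
    ... | no i≢x   =
      trans (agree λ { (here i≡x) → i≢x i≡x ; (there i∈xs) → i∉xs i∈xs }) (sym (lookup-∪⁅⁆-≢ L i≢x))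
    fresh′ : ∀ {i} → i ∈ xs → lookup (L ∪ ⁅ x ⁆) i ≡ false
    fresh′ i∈xs = trans (lookup-∪⁅⁆-≢ L λ { refl → x∉xs i∈xs }) (fresh (there i∈xs))

  Extends-skip : ∀ {xs x L t} → lookup t x ≡ false → Extends (x ∷ xs) L t → Extends xs L t
  Extends-skip {xs} {x} {L} {t} tx (extends agree fresh) = extends agree′ (fresh ∘ there)
    where
    agree′ : ∀ {i} → i ∉ xs → lookup t i ≡ lookup L i
    agree′ {i} i∉xs with i Fin.≟ x
    ... | yes refl = trans tx (sym (fresh (here refl)))
    ... | no i≢x   = agree λ { (here i≡x) → i≢x i≡x ; (there i∈xs) → i∉xs i∈xs }

  mass-loop-≢ : ∀ xs w L t {i} → i ∉ xs → lookup t i ≢ lookup L i → mass (loop xs w L) t ≡ 0ℚ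
  mass-loop-≢ []       w       L t {i} _ t≢L = mass-return-≢ {L} {t} (t≢L ∘ cong (λ s → lookup s i) ∘ sym)
  mass-loop-≢ (x ∷ xs) zero    L t {i} _ t≢L = mass-return-≢ {L} {t} (t≢L ∘ cong (λ s → lookup s i) ∘ sym)
  mass-loop-≢ (x ∷ xs) (suc k) L t i∉ t≢L =
    mass-branch-≡0 (tie-test xs x (suc k)) (V xs (suc k) <⊥ᵇ V (x ∷ xs) (suc k))
      (ratio (C xs (suc k ∸ wt x)) (C (x ∷ xs) (suc k)))
      (loop xs (suc k ∸ wt x) (L ∪ ⁅ x ⁆)) (loop xs (suc k) L) t
      (mass-loop-≢ xs _ (L ∪ ⁅ x ⁆) t (i∉ ∘ there) λ ti≡ → t≢L (trans ti≡ (lookup-∪⁅⁆-≢ L (i∉ ∘ here))))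
      (mass-loop-≢ xs _ L t (i∉ ∘ there) t≢L)

  mass-loop-∷-∈ : ∀ xs x k L t → wt x ≤ suc k → V (x ∷ xs) (suc k) ≡ V xs (suc k ∸ wt x) +⊥ val x →
                  mass (loop xs (suc k ∸ wt x) (L ∪ ⁅ x ⁆)) t ≡ inv (C xs (suc k ∸ wt x)) →
                  mass (loop xs (suc k) L) t ≡ 0ℚ →
                  mass (loop (x ∷ xs) (suc k) L) t ≡ inv (C (x ∷ xs) (suc k))
  mass-loop-∷-∈ xs x k L t x≤w V≡ taken skipped with choice xs x (suc k)
  ... | skip below v≡ _  =
    contradiction (subst (V xs (suc k ∸ wt x) +⊥ val x <⊥_) (trans (sym v≡) V≡) (below x≤w)) <⊥-irrefl
  ... | take _ V<S v≡ c≡ = begin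
    mass (loop (x ∷ xs) (suc k) L) t              ≡⟨ cong (λ d → mass d t) (loop-take xs x k L V<v) ⟩
    mass (loop xs (suc k ∸ wt x) (L ∪ ⁅ x ⁆)) t ≡⟨ taken ⟩
    inv (C xs (suc k ∸ wt x))                     ≡⟨ cong inv c≡ ⟨
    inv (C (x ∷ xs) (suc k))                      ∎
    where
    open ≡-Reasoning
    V<v : V xs (suc k) <⊥ V (x ∷ xs) (suc k)
    V<v = subst (V xs (suc k) <⊥_) (sym v≡) V<S
  ... | both _ tie v≡ _  = begin
    mass (loop (x ∷ xs) (suc k) L) t
      ≡⟨ trans (cong (λ d → mass d t) (loop-both xs x k L x≤w tie v≡)) (mass-bernoulli q d₁ d₂ t) ⟩
    q ℚ.* mass d₁ t ℚ.+ (1ℚ ℚ.- q) ℚ.* mass d₂ t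
      ≡⟨ cong₂ (λ a b → q ℚ.* a ℚ.+ (1ℚ ℚ.- q) ℚ.* b) taken skipped ⟩
    q ℚ.* inv a ℚ.+ (1ℚ ℚ.- q) ℚ.* 0ℚ
      ≡⟨ trans (cong (q ℚ.* inv a ℚ.+_) (ℚP.*-zeroʳ (1ℚ ℚ.- q))) (ℚP.+-identityʳ _) ⟩
    q ℚ.* inv a
      ≡⟨ ratio-*-inv (C (x ∷ xs) (suc k)) (C-pos xs (suc k ∸ wt x)) ⟩
    inv (C (x ∷ xs) (suc k)) ∎
    where
    open ≡-Reasoning
    a : ℕ
    a = C xs (suc k ∸ wt x)
    q : ℚ
    q = ratio a (C (x ∷ xs) (suc k))
    d₁ d₂ : Dist (Subset n)
    d₁ = loop xs (suc k ∸ wt x) (L ∪ ⁅ x ⁆)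
    d₂ = loop xs (suc k) L

  mass-loop-∷-∉ : ∀ xs x k L t → V (x ∷ xs) (suc k) ≡ V xs (suc k) →
                  mass (loop xs (suc k ∸ wt x) (L ∪ ⁅ x ⁆)) t ≡ 0ℚ →
                  mass (loop xs (suc k) L) t ≡ inv (C xs (suc k)) →
                  mass (loop (x ∷ xs) (suc k) L) t ≡ inv (C (x ∷ xs) (suc k))
  mass-loop-∷-∉ xs x k L t V≡ taken skipped with choice xs x (suc k)
  ... | take _ V<S v≡ _    = contradiction (subst (V xs (suc k) <⊥_) (trans (sym v≡) V≡) V<S) <⊥-irrefl
  ... | skip below v≡ c≡   = begin
    mass (loop (x ∷ xs) (suc k) L) t ≡⟨ cong (λ d → mass d t) (loop-skip xs x k L below v≡) ⟩
    mass (loop xs (suc k) L) t       ≡⟨ skipped ⟩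
    inv (C xs (suc k))               ≡⟨ cong inv c≡ ⟨
    inv (C (x ∷ xs) (suc k))         ∎
    where open ≡-Reasoning
  ... | both x≤w tie v≡ c≡ = begin
    mass (loop (x ∷ xs) (suc k) L) t
      ≡⟨ trans (cong (λ d → mass d t) (loop-both xs x k L x≤w tie v≡)) (mass-bernoulli q d₁ d₂ t) ⟩
    q ℚ.* mass d₁ t ℚ.+ (1ℚ ℚ.- q) ℚ.* mass d₂ t
      ≡⟨ cong₂ (λ a b → q ℚ.* a ℚ.+ (1ℚ ℚ.- q) ℚ.* b) taken skipped ⟩
    q ℚ.* 0ℚ ℚ.+ (1ℚ ℚ.- q) ℚ.* inv b
      ≡⟨ trans (cong (ℚ._+ (1ℚ ℚ.- q) ℚ.* inv b) (ℚP.*-zeroʳ q)) (ℚP.+-identityˡ _) ⟩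
    (1ℚ ℚ.- q) ℚ.* inv b
      ≡⟨ cong (λ c → (1ℚ ℚ.- ratio a c) ℚ.* inv b) c≡ ⟩
    (1ℚ ℚ.- ratio a (b + a)) ℚ.* inv b
      ≡⟨ cong (ℚ._* inv b) (1-ratio a b (C-pos xs (suc k ∸ wt x)) (C-pos xs (suc k))) ⟩
    ratio b (b + a) ℚ.* inv b
      ≡⟨ ratio-*-inv (b + a) (C-pos xs (suc k)) ⟩
    inv (b + a)
      ≡⟨ cong inv c≡ ⟨
    inv (C (x ∷ xs) (suc k)) ∎
    where
    open ≡-Reasoning
    a b : ℕ
    a = C xs (suc k ∸ wt x)
    b = C xs (suc k)
    q : ℚ
    q = ratio a (C (x ∷ xs) (suc k))
    d₁ d₂ : Dist (Subset n)
    d₁ = loop xs (suc k ∸ wt x) (L ∪ ⁅ x ⁆)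
    d₂ = loop xs (suc k) L

  mass-loop : (∀ i → 0 < wt i) → ∀ xs w L t → Unique xs → Extends xs L t → OptimalOn xs w t →
              mass (loop xs w L) t ≡ inv (C xs w)
  mass-loop pos []       w       L t _ ext _ =
    subst (λ s → mass (return s) t ≡ 1ℚ) (Extends-[] ext) (mass-return-≡ t)
  mass-loop pos (x ∷ xs) zero    L t _ (extends agree fresh) opt = begin
    mass (return L) t ≡⟨ cong (λ s → mass (return s) t) t≡L ⟨
    mass (return t) t ≡⟨ mass-return-≡ t ⟩
    1ℚ                ≡⟨ cong inv (C-zero pos (x ∷ xs)) ⟨
    inv (C (x ∷ xs) 0) ∎
    where
    open ≡-Reasoning
    t≡L : t ≡ L
    t≡L = lookup-ext t L λ i → case (i ∈? (x ∷ xs))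
      where
      case : ∀ {i} → Dec (i ∈ x ∷ xs) → lookup t i ≡ lookup L i
      case (yes i∈) = trans (weightOn≤0⇒∉ pos (x ∷ xs) {t} (OptimalOn.feasible opt) i∈) (sym (fresh i∈))
      case (no i∉)  = agree i∉
  mass-loop pos (x ∷ xs) (suc k) L t (x∉ ∷ u) ext opt with lookup t x BoolP.≟ true
  ... | yes tx =
    let x≤w , opt′ , V≡ = OptimalOn-∷-∈⁻ tx opt in
    mass-loop-∷-∈ xs x k L t x≤w V≡
      (mass-loop pos xs (suc k ∸ wt x) (L ∪ ⁅ x ⁆) t u (Extends-take (All¬⇒¬Any x∉) tx ext) opt′)
      (mass-loop-≢ xs (suc k) L t (All¬⇒¬Any x∉) λ tx≡Lx →
         true≢false (trans (sym tx) (trans tx≡Lx (Extends.fresh ext (here refl)))))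
  ... | no ¬tx =
    let tx = BoolP.¬-not ¬tx ; opt′ , V≡ = OptimalOn-∷-∉⁻ tx opt in
    mass-loop-∷-∉ xs x k L t V≡
      (mass-loop-≢ xs (suc k ∸ wt x) (L ∪ ⁅ x ⁆) t (All¬⇒¬Any x∉) λ tx≡Lx →
         true≢false (trans (sym (lookup-∪⁅⁆-≡ L x)) (trans (sym tx≡Lx) tx)))
      (mass-loop pos xs (suc k) L t u (Extends-skip tx ext) opt′)

  allItems : List (Fin n)
  allItems = reverse (allFin n)

  ∈-allItems : ∀ i → i ∈ allItems
  ∈-allItems i = reverse⁺ (∈P.∈-allFin i)

  unique-allItems : Unique allItems
  unique-allItems = unique-reverse (UniqueP.allFin⁺ n)

  weight≡weightOn : ∀ t → weight t ≡ weightOn allItems t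
  weight≡weightOn t =
    sym (foldr-reverse ℕP.+-0-isCommutativeMonoid (λ i → if lookup t i then wt i else 0) (allFin n))

  value≡valueOn : ∀ t → value t ≡ valueOn allItems t
  value≡valueOn t =
    sym (foldr-reverse ℤP.+-0-isCommutativeMonoid (λ i → if lookup t i then val i else + 0) (allFin n))

  Optimal⇒OptimalOn : ∀ {s} → Optimal s → OptimalOn allItems W s
  Optimal⇒OptimalOn {s} (feasible , best) =
    optimalOn feasible′ (≤⊥-antisym (valueOn≤V allItems W s feasible′) V≤s)
    where
    feasible′ : weightOn allItems s ≤ W
    feasible′ = subst (_≤ W) (weight≡weightOn s) feasible
    g : Subset n
    g = proj₁ (OptimalOn-exists allItems W unique-allItems)
    opt : OptimalOn allItems W g
    opt = proj₂ (OptimalOn-exists allItems W unique-allItems)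
    g≤s : valueOn allItems g ℤ.≤ valueOn allItems s
    g≤s = subst₂ ℤ._≤_ (value≡valueOn g) (value≡valueOn s)
            (best g (subst (_≤ W) (sym (weight≡weightOn g)) (OptimalOn.feasible opt)))
    V≤s : V allItems W ≤⊥ fin (valueOn allItems s)
    V≤s = subst (_≤⊥ fin (valueOn allItems s)) (OptimalOn.attains opt) (fin≤fin g≤s)

  OptimalOn⇒Optimal : ∀ {s} → OptimalOn allItems W s → Optimal s
  OptimalOn⇒Optimal {s} (optimalOn feasible attains) = subst (_≤ W) (sym (weight≡weightOn s)) feasible , best
    where
    best : ∀ t → Feasible t → value t ℤ.≤ value s
    best t t-feasible = subst₂ ℤ._≤_ (sym (value≡valueOn t)) (sym (value≡valueOn s))
      (fin≤fin⁻¹ (subst (fin (valueOn allItems t) ≤⊥_) (sym attains)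
                       (valueOn≤V allItems W t (subst (_≤ W) (weight≡weightOn t) t-feasible))))

  ∈optimals⇔Optimal : ∀ s → s ∈ optimals allItems W ⇔ Optimal s
  ∈optimals⇔Optimal s =
    mk⇔ (OptimalOn⇒Optimal ∘ proj₂ ∘ optimals-sound unique-allItems)
        (optimals-complete unique-allItems (within λ i∉ → contradiction (∈-allItems _) i∉) ∘ Optimal⇒OptimalOn)

  count-optimal : ∀ {S*} → Unique S* → (∀ s → s ∈ S* ⇔ Optimal s) → length S* ≡ C allItems W
  count-optimal unique-S* S*⇔Optimal =
    trans (length-unique-≡ unique-S* (optimals-unique allItems W unique-allItems)
                           λ {s} → ⇔.trans (S*⇔Optimal s) (⇔.sym (∈optimals⇔Optimal s)))
          (length-optimals allItems W)

  Pr-optimal : (∀ i → 0 < wt i) → ∀ {s} → Optimal s → Pr s ≡ inv (C allItems W)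
  Pr-optimal pos {s} s-optimal =
    mass-loop pos allItems W ∅ s unique-allItems
      (extends (λ i∉ → contradiction (∈-allItems _) i∉) (λ {i} _ → VecP.lookup-replicate i false))
      (Optimal⇒OptimalOn s-optimal)

theorem2 : (n : ℕ) (wt : Fin n → ℕ) (val : Fin n → ℤ) (W : ℕ)
    → (∀ i → 0 < wt i) → 0 < W
    → (Sstar : List (Subset n)) → Unique Sstar
    → (∀ s → (s ∈ Sstar) ⇔ Knapsack.Optimal wt val W s)
    → ∀ s → Knapsack.Optimal wt val W s
    → Knapsack.Pr wt val W s ≡ inv (length Sstar)
theorem2 n wt val W pos _ Sstar unique-S* S*⇔Optimal s s-optimal =
  trans (Pr-optimal wt val W pos s-optimal) (cong inv (sym (count-optimal wt val W unique-S* S*⇔Optimal)))
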